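{- A core graph cannot contain $K_4$ or its complement $\overline{K_4}$ as a proper induced subgraph.
   Context: All graphs are finite and simple. For a graph $G$, let $P(G)$ be the polytope in $\mathbb{R}^{V(G)}$ defined by $0\le x_v\le 1$ for every vertex $v$, $x_u+x_v\le 1$ for every edge $uv$, and $\sum_{v\in V(C)}x_v\le (|V(C)|-1)/2$ for every induced odd cycle $C$. $G$ is t-perfect if $P(G)$ equals the convex hull of characteristic vectors of independent sets of $G$, t-imperfect otherwise. If $N(v)$ is an independent set, the t-contraction at $v$ contracts $N(v)\cup\{v\}$ into a single vertex. A t-minor of $G$ is a graph obtained by a sequence of vertex deletions and t-contractions; it is proper if it has fewer vertices than $G$. A graph $G$ is a core graph if neither $G$ nor its complement $\overline{G}$ has a t-imperfect proper t-minor. -}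

module Defs where

open import Data.Nat using (ℕ; zero; suc; _+_; _*_; _<_)
open import Data.Nat.DivMod using (_%_)
open import Data.Fin using (Fin; toℕ; _≟_)
open import Data.Bool using (Bool; true; false; not; if_then_else_)
open import Data.Rational using (ℚ; 0ℚ; 1ℚ) renaming (_+_ to _+ℚ_; _≤_ to _≤ℚ_)
open import Data.List using (List; []; _∷_; map; filter)
open import Data.List.Relation.Unary.All using (All)
open import Data.Product using (Σ; ∃; _×_; _,_; proj₁; proj₂)
open import Data.Sum using (_⊎_)
open import Data.Empty using (⊥-elim)
open import Relation.Nullary using (¬_; yes; no; isYes)
open import Relation.Binary.PropositionalEquality using (_≡_; _≢_; refl; sym; cong)
open import Function.Definitions using (Injective; Surjective)
open import Function.Bundles using (_⇔_)

record Graph (n : ℕ) : Set where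
  field
    adj    : Fin n → Fin n → Bool
    adjSym : ∀ u v → adj u v ≡ adj v u
    adjIrr : ∀ v → adj v v ≡ false
open Graph public

complement : ∀ {n} → Graph n → Graph n
complement {n} G = record { adj = a ; adjSym = s ; adjIrr = i }
  where
  a : Fin n → Fin n → Bool
  a u v = if isYes (u ≟ v) then false else not (adj G u v)
  s : ∀ u v → a u v ≡ a v u
  s u v with u ≟ v | v ≟ u
  ... | yes _ | yes _ = refl
  ... | yes p | no q  = ⊥-elim (q (sym p))
  ... | no p  | yes q = ⊥-elim (p (sym q))
  ... | no _  | no _  = cong not (adjSym G u v)
  i : ∀ v → a v v ≡ false
  i v with v ≟ v
  ... | yes _ = refl
  ... | no p  = ⊥-elim (p refl)

complete : (n : ℕ) → Graph n
complete n = record { adj = a ; adjSym = s ; adjIrr = i }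
  where
  a : Fin n → Fin n → Bool
  a u v = not (isYes (u ≟ v))
  s : ∀ u v → a u v ≡ a v u
  s u v with u ≟ v | v ≟ u
  ... | yes _ | yes _ = refl
  ... | yes p | no q  = ⊥-elim (q (sym p))
  ... | no p  | yes q = ⊥-elim (p (sym q))
  ... | no _  | no _  = refl
  i : ∀ v → a v v ≡ false
  i v with v ≟ v
  ... | yes _ = refl
  ... | no p  = ⊥-elim (p refl)

K4 : Graph 4
K4 = complete 4

InducedSubgraph : ∀ {m n} → Graph m → Graph n → Set
InducedSubgraph {m} {n} H G =
  Σ (Fin m → Fin n) λ e → Injective _≡_ _≡_ e × (∀ a b → adj H a b ≡ adj G (e a) (e b))

sumFin : ∀ {k} → (Fin k → ℚ) → ℚ
sumFin {zero}  f = 0ℚ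
sumFin {suc k} f = f Fin.zero +ℚ sumFin (λ i → f (Fin.suc i))

cycLen : ℕ → ℕ
cycLen k = 3 + 2 * k

CycAdjacent : ∀ {L} → Fin (suc L) → Fin (suc L) → Set
CycAdjacent {L} i j =
  toℕ j ≡ (suc (toℕ i)) % (suc L) ⊎ toℕ i ≡ (suc (toℕ j)) % (suc L)

InducedOddCycle : ∀ {n} → Graph n → (k : ℕ) → (Fin (cycLen k) → Fin n) → Set
InducedOddCycle G k c =
  Injective _≡_ _≡_ c × (∀ i j → (adj G (c i) (c j) ≡ true) ⇔ CycAdjacent i j)

ℕtoℚ : ℕ → ℚ
ℕtoℚ zero = 0ℚ
ℕtoℚ (suc m) = 1ℚ +ℚ ℕtoℚ m

InP : ∀ {n} → Graph n → (Fin n → ℚ) → Set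
InP {n} G x =
  (∀ v → (0ℚ ≤ℚ x v) × (x v ≤ℚ 1ℚ)) ×
  (∀ u v → adj G u v ≡ true → (x u +ℚ x v) ≤ℚ 1ℚ) ×
  (∀ k (c : Fin (cycLen k) → Fin n) → InducedOddCycle G k c →
     sumFin (λ i → x (c i)) ≤ℚ ℕtoℚ (suc k))   -- (|C|-1)/2 = k+1

VSet : ℕ → Set
VSet n = Fin n → Bool

Independent : ∀ {n} → Graph n → VSet n → Set
Independent G S = ∀ u v → S u ≡ true → S v ≡ true → adj G u v ≡ false

sumList : List ℚ → ℚ
sumList [] = 0ℚ
sumList (q ∷ qs) = q +ℚ sumList qs

weightAt : ∀ {n} → Fin n → List (ℚ × VSet n) → ℚ
weightAt v [] = 0ℚ
weightAt v ((w , S) ∷ ws) = (if S v then w else 0ℚ) +ℚ weightAt v ws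

InStableHull : ∀ {n} → Graph n → (Fin n → ℚ) → Set
InStableHull {n} G x =
  Σ (List (ℚ × VSet n)) λ L →
    All (λ p → (0ℚ ≤ℚ proj₁ p) × Independent G (proj₂ p)) L ×
    sumList (map proj₁ L) ≡ 1ℚ ×
    (∀ v → x v ≡ weightAt v L)

TPerfect : ∀ {n} → Graph n → Set
TPerfect G = ∀ x → (InP G x → InStableHull G x) × (InStableHull G x → InP G x)

DeletionStep : ∀ {n m} → Graph n → Graph m → Set
DeletionStep {n} {m} G H =
  Σ (Fin n) λ v → Σ (Fin m → Fin n) λ e →
    Injective _≡_ _≡_ e × (∀ a → e a ≢ v) × (∀ u → u ≢ v → ∃ λ a → e a ≡ u) ×
    (∀ a b → adj H a b ≡ adj G (e a) (e b))

ClosedNbhd : ∀ {n} → Graph n → Fin n → Fin n → Set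
ClosedNbhd G v u = u ≡ v ⊎ adj G v u ≡ true

-- H ≅ graph obtained from G by contracting N(v) ∪ {v}, N(v) independent
ContractionStep : ∀ {n m} → Graph n → Graph m → Set
ContractionStep {n} {m} G H =
  Σ (Fin n) λ v →
    (∀ u w → adj G v u ≡ true → adj G v w ≡ true → adj G u w ≡ false) ×
    Σ (Fin n → Fin m) λ f →
      Surjective _≡_ _≡_ f ×
      (∀ x y → (f x ≡ f y) ⇔ (x ≡ y ⊎ (ClosedNbhd G v x × ClosedNbhd G v y))) ×
      (∀ a b → (adj H a b ≡ true) ⇔
         (a ≢ b × Σ (Fin n) λ x → Σ (Fin n) λ y → f x ≡ a × f y ≡ b × adj G x y ≡ true))

data TMinor : ∀ {n m} → Graph n → Graph m → Set where
  tm-refl : ∀ {n} {G : Graph n} → TMinor G G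
  tm-del  : ∀ {n m k} {G : Graph n} {H : Graph m} {K : Graph k} →
            DeletionStep G H → TMinor H K → TMinor G K
  tm-con  : ∀ {n m k} {G : Graph n} {H : Graph m} {K : Graph k} →
            ContractionStep G H → TMinor H K → TMinor G K

HasTImperfectProperTMinor : ∀ {n} → Graph n → Set
HasTImperfectProperTMinor {n} G =
  Σ ℕ λ m → Σ (Graph m) λ H → TMinor G H × m < n × ¬ TPerfect H

CoreGraph : ∀ {n} → Graph n → Set
CoreGraph G = ¬ HasTImperfectProperTMinor G × ¬ HasTImperfectProperTMinor (complement G)

-- A proper induced subgraph is a t-minor: delete the missing vertices one
-- at a time. K₄ is t-imperfect: the point with every coordinate 1/3 lies in
-- P(K₄), since the only induced odd cycles of a complete graph are
-- triangles, but its coordinate sum 4/3 exceeds 1, the largest coordinate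
-- sum in the stable set polytope of a complete graph. Finally K̄₄ is an
-- induced subgraph of G exactly when K₄ is one of Ḡ.
module Submission where

open import Defs
open import Data.Nat using (ℕ; _<_)
open import Data.Product using (_×_)
open import Relation.Nullary using (¬_)

open import Data.Nat using (zero; suc; _≤_; z≤n; s≤s; s≤s⁻¹)
import Data.Nat.Properties as ℕ
open import Data.Fin using (Fin; zero; suc; punchIn; punchOut; _≟_)
open import Data.Fin.Properties using (suc-injective; punchIn-injective; punchInᵢ≢i;
  punchIn-punchOut; punchOut-injective; injective⇒≤; ¬∀⟶∃¬; any?)
open import Data.Bool using (true; false; not; if_then_else_)
open import Data.Bool.Properties using (not-involutive)
open import Data.Product using (∃; _,_; proj₁; proj₂)
import Data.Product as Product
open import Data.Sum using (inj₁; inj₂)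
open import Data.List using (List; _∷_; []; map)
open import Data.List.Relation.Unary.All using (All; _∷_; [])
open import Data.Integer using (+_)
open import Data.Rational using (ℚ; 0ℚ; 1ℚ; _/_)
  renaming (_+_ to _+ℚ_; _≤_ to _≤ℚ_; _<_ to _<ℚ_)
import Data.Rational.Properties as ℚ
open import Algebra.Bundles using (CommutativeMonoid)
open import Algebra.Properties.CommutativeSemigroup
  (CommutativeMonoid.commutativeSemigroup ℚ.+-0-commutativeMonoid) using (interchange)
open import Function using (_∘_)
open import Function.Bundles using (Equivalence)
open import Function.Definitions using (Injective)
open import Relation.Nullary using (yes; no; contradiction)
open import Relation.Nullary.Decidable using (from-yes)
open import Relation.Binary.PropositionalEquality
  using (_≡_; _≢_; refl; sym; trans; cong; cong₂; module ≡-Reasoning)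

private
  variable
    m n : ℕ

module _ {e : Fin m → Fin (suc n)} {v : Fin (suc n)} (e∌v : ∀ a → e a ≢ v) where

  punchOut∘ : Fin m → Fin n
  punchOut∘ a = punchOut (e∌v a ∘ sym)

  punchOut∘-injective : Injective _≡_ _≡_ e → Injective _≡_ _≡_ punchOut∘
  punchOut∘-injective e-inj eq = e-inj (punchOut-injective (e∌v _ ∘ sym) (e∌v _ ∘ sym) eq)

missing⇒< : {e : Fin m → Fin n} → Injective _≡_ _≡_ e → (v : Fin n) → (∀ a → e a ≢ v) → m < n
missing⇒< {n = suc _} e-inj v e∌v = s≤s (injective⇒≤ (punchOut∘-injective e∌v e-inj))

<⇒missing : {e : Fin m → Fin n} → Injective _≡_ _≡_ e → m < n → ∃ λ v → ∀ a → e a ≢ v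
<⇒missing {m} {n} {e} e-inj m<n =
  Product.map₂ (λ v∉e a eq → v∉e (a , eq))
    (¬∀⟶∃¬ n (λ v → ∃ λ a → e a ≡ v) (λ v → any? (λ a → e a ≟ v)) ¬surjective)
  where
  ¬surjective : ¬ (∀ v → ∃ λ a → e a ≡ v)
  ¬surjective hit = ℕ.<⇒≱ m<n (injective⇒≤ {f = proj₁ ∘ hit} section-injective)
    where
    section-injective : Injective _≡_ _≡_ (proj₁ ∘ hit)
    section-injective {u} {w} eq = trans (sym (proj₂ (hit u))) (trans (cong e eq) (proj₂ (hit w)))

missingOne⇒hitsRest : {e : Fin m → Fin (suc m)} → Injective _≡_ _≡_ e →
  ∀ v → (∀ a → e a ≢ v) → ∀ u → u ≢ v → ∃ λ a → e a ≡ u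
missingOne⇒hitsRest {e = e} e-inj v e∌v u u≢v with any? (λ a → e a ≟ u)
... | yes hit = hit
... | no ¬hit = contradiction
  (missing⇒< (punchOut∘-injective e∌v e-inj) (punchOut (u≢v ∘ sym)) punchOut∘∌u)
  (ℕ.<-irrefl refl)
  where
  punchOut∘∌u : ∀ a → punchOut∘ e∌v a ≢ punchOut (u≢v ∘ sym)
  punchOut∘∌u a eq = ¬hit (a , punchOut-injective (e∌v a ∘ sym) (u≢v ∘ sym) eq)

deleteVertex : Graph (suc n) → Fin (suc n) → Graph n
deleteVertex G v = record
  { adj    = λ a b → adj G (punchIn v a) (punchIn v b)
  ; adjSym = λ a b → adjSym G (punchIn v a) (punchIn v b)
  ; adjIrr = λ a → adjIrr G (punchIn v a)
  }

deleteVertex-step : (G : Graph (suc n)) (v : Fin (suc n)) → DeletionStep G (deleteVertex G v)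
deleteVertex-step G v =
  v , punchIn v , punchIn-injective v _ _ , punchInᵢ≢i v ,
  (λ u u≢v → punchOut (u≢v ∘ sym) , punchIn-punchOut _) ,
  (λ a b → refl)

induced-deleteVertex : {H : Graph m} {G : Graph (suc n)} {v : Fin (suc n)} →
  (H⊆G : InducedSubgraph H G) → (∀ a → proj₁ H⊆G a ≢ v) →
  InducedSubgraph H (deleteVertex G v)
induced-deleteVertex {H = H} {G} {v} (e , e-inj , adj≡) e∌v =
  punchOut∘ e∌v , punchOut∘-injective e∌v e-inj , adj≡′
  where
  adj≡′ : ∀ a b → adj H a b ≡ adj G (punchIn v (punchOut∘ e∌v a)) (punchIn v (punchOut∘ e∌v b))
  adj≡′ a b = trans (adj≡ a b) (sym (cong₂ (adj G) (punchIn-punchOut _) (punchIn-punchOut _)))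

induced⇒TMinor : {H : Graph m} {G : Graph n} → InducedSubgraph H G → m < n → TMinor G H
induced⇒TMinor {n = suc _} {H = H} {G = G} H⊆G@(e , e-inj , adj≡) m<n
  with <⇒missing e-inj m<n | ℕ.m≤n⇒m<n∨m≡n (s≤s⁻¹ m<n)
... | v , e∌v | inj₂ refl =
  -- tm-refl ends a chain only at a graph equal to H, so the last deletion
  -- goes along e itself rather than through deleteVertex.
  tm-del (v , e , e-inj , e∌v , missingOne⇒hitsRest e-inj v e∌v , adj≡) tm-refl
... | v , e∌v | inj₁ m<n-1 =
  tm-del {H = deleteVertex G v} (deleteVertex-step G v)
    (induced⇒TMinor (induced-deleteVertex {H = H} {G = G} H⊆G e∌v) m<n-1)

complement-adj : (G : Graph n) {u v : Fin n} → u ≢ v → adj (complement G) u v ≡ not (adj G u v)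
complement-adj G {u} {v} u≢v with u ≟ v
... | yes u≡v = contradiction u≡v u≢v
... | no _    = refl

complement-induced : {H : Graph m} {G : Graph n} →
  InducedSubgraph (complement H) G → InducedSubgraph H (complement G)
complement-induced {H = H} {G} (e , e-inj , adj≡) = e , e-inj , adj≡′
  where
  open ≡-Reasoning
  adj≡′ : ∀ a b → adj H a b ≡ adj (complement G) (e a) (e b)
  adj≡′ a b with a ≟ b
  ... | yes refl = trans (adjIrr H a) (sym (adjIrr (complement G) (e a)))
  ... | no a≢b = begin
    adj H a b                      ≡⟨ not-involutive _ ⟨
    not (not (adj H a b))          ≡⟨ cong not (complement-adj H a≢b) ⟨
    not (adj (complement H) a b)   ≡⟨ cong not (adj≡ a b) ⟩
    not (adj G (e a) (e b))        ≡⟨ complement-adj G (a≢b ∘ e-inj) ⟨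
    adj (complement G) (e a) (e b) ∎

complete-adj : {u v : Fin n} → u ≢ v → adj (complete n) u v ≡ true
complete-adj {u = u} {v} u≢v with u ≟ v
... | yes u≡v = contradiction u≡v u≢v
... | no _    = refl

complete-nonadjacent⇒≡ : {u v : Fin n} → adj (complete n) u v ≡ false → u ≡ v
complete-nonadjacent⇒≡ {u = u} {v} with u ≟ v
... | yes u≡v = λ _ → u≡v
... | no _    = λ ()

complete-¬longInducedOddCycle : ∀ k {c : Fin (cycLen (suc k)) → Fin n} →
  ¬ InducedOddCycle (complete n) (suc k) c
-- c₀c₂ is a chord: adjacent in Kₙ but not consecutive on a cycle of length ≥ 5.
complete-¬longInducedOddCycle k (c-inj , adj⇔)
  with Equivalence.to (adj⇔ zero (suc (suc zero))) (complete-adj ((λ ()) ∘ c-inj))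
... | inj₁ ()
... | inj₂ ()

sumFin-cong : {f g : Fin n → ℚ} → (∀ i → f i ≡ g i) → sumFin f ≡ sumFin g
sumFin-cong {n = zero}  f≡g = refl
sumFin-cong {n = suc _} f≡g = cong₂ _+ℚ_ (f≡g zero) (sumFin-cong (f≡g ∘ suc))

sumFin-0 : ∀ n → sumFin {n} (λ _ → 0ℚ) ≡ 0ℚ
sumFin-0 zero    = refl
sumFin-0 (suc n) = trans (ℚ.+-identityˡ _) (sumFin-0 n)

sumFin-+ : (f g : Fin n → ℚ) → sumFin (λ i → f i +ℚ g i) ≡ sumFin f +ℚ sumFin g
sumFin-+ {n = zero}  f g = refl
sumFin-+ {n = suc _} f g = trans
  (cong (f zero +ℚ g zero +ℚ_) (sumFin-+ (f ∘ suc) (g ∘ suc)))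
  (interchange (f zero) (g zero) _ _)

sumFin-nonneg : {f : Fin n → ℚ} → (∀ i → 0ℚ ≤ℚ f i) → 0ℚ ≤ℚ sumFin f
sumFin-nonneg {n = zero}  0≤f = ℚ.≤-refl
sumFin-nonneg {n = suc _} 0≤f = ℚ.+-mono-≤ (0≤f zero) (sumFin-nonneg (0≤f ∘ suc))

AtMostOne : VSet n → Set
AtMostOne S = ∀ u v → S u ≡ true → S v ≡ true → u ≡ v

atMostOne⇒weightedSum≤ : {S : VSet n} {w : ℚ} → AtMostOne S → 0ℚ ≤ℚ w →
  sumFin (λ v → if S v then w else 0ℚ) ≤ℚ w
atMostOne⇒weightedSum≤ {n = zero}  S≤1 0≤w = 0≤w
atMostOne⇒weightedSum≤ {n = suc n} {S} {w} S≤1 0≤w with S zero in S0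
... | true  = ℚ.≤-reflexive (begin
  w +ℚ sumFin (λ i → if S (suc i) then w else 0ℚ) ≡⟨ cong (w +ℚ_) (sumFin-cong rest-empty) ⟩
  w +ℚ sumFin {n} (λ _ → 0ℚ)                      ≡⟨ cong (w +ℚ_) (sumFin-0 n) ⟩
  w +ℚ 0ℚ                                         ≡⟨ ℚ.+-identityʳ w ⟩
  w                                               ∎)
  where
  open ≡-Reasoning
  rest-empty : ∀ i → (if S (suc i) then w else 0ℚ) ≡ 0ℚ
  rest-empty i with S (suc i) in Si
  ... | true  = contradiction (S≤1 zero (suc i) S0 Si) λ ()
  ... | false = refl
... | false = ℚ.≤-trans (ℚ.≤-reflexive (ℚ.+-identityˡ _))
  (atMostOne⇒weightedSum≤ (λ u v Su Sv → suc-injective (S≤1 (suc u) (suc v) Su Sv)) 0≤w)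

complete-independent⇒atMostOne : {S : VSet n} → Independent (complete n) S → AtMostOne S
complete-independent⇒atMostOne S-indep u v Su Sv = complete-nonadjacent⇒≡ (S-indep u v Su Sv)

complete-sumWeightAt≤ : (L : List (ℚ × VSet n)) →
  All (λ p → (0ℚ ≤ℚ proj₁ p) × Independent (complete n) (proj₂ p)) L →
  sumFin (λ v → weightAt v L) ≤ℚ sumList (map proj₁ L)
complete-sumWeightAt≤ {n} [] [] = ℚ.≤-reflexive (sumFin-0 n)
complete-sumWeightAt≤ ((w , S) ∷ L) ((0≤w , S-indep) ∷ L-valid) = begin
  sumFin (λ v → (if S v then w else 0ℚ) +ℚ weightAt v L)
    ≡⟨ sumFin-+ (λ v → if S v then w else 0ℚ) (λ v → weightAt v L) ⟩
  sumFin (λ v → if S v then w else 0ℚ) +ℚ sumFin (λ v → weightAt v L)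
    ≤⟨ ℚ.+-mono-≤ (atMostOne⇒weightedSum≤ (complete-independent⇒atMostOne S-indep) 0≤w)
                  (complete-sumWeightAt≤ L L-valid) ⟩
  w +ℚ sumList (map proj₁ L)
    ∎
  where open ℚ.≤-Reasoning

complete-stableHull⇒sum≤1 : {x : Fin n → ℚ} → InStableHull (complete n) x → sumFin x ≤ℚ 1ℚ
complete-stableHull⇒sum≤1 {x = x} (L , L-valid , total≡1 , x≡) = begin
  sumFin x                    ≡⟨ sumFin-cong x≡ ⟩
  sumFin (λ v → weightAt v L) ≤⟨ complete-sumWeightAt≤ L L-valid ⟩
  sumList (map proj₁ L)       ≡⟨ total≡1 ⟩
  1ℚ                          ∎
  where open ℚ.≤-Reasoning

⅓ : ℚ
⅓ = + 1 / 3

0≤⅓ : 0ℚ ≤ℚ ⅓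
0≤⅓ = from-yes (0ℚ ℚ.≤? ⅓)

⅓∈P-complete : InP (complete n) (λ _ → ⅓)
⅓∈P-complete =
  (λ _ → 0≤⅓ , from-yes (⅓ ℚ.≤? 1ℚ)) ,
  (λ _ _ _ → from-yes (⅓ +ℚ ⅓ ℚ.≤? 1ℚ)) ,
  oddCycle≤
  where
  oddCycle≤ : ∀ k (c : Fin (cycLen k) → Fin n) → InducedOddCycle (complete n) k c →
    sumFin {cycLen k} (λ _ → ⅓) ≤ℚ ℕtoℚ (suc k)
  oddCycle≤ zero    _ _ = from-yes (sumFin {3} (λ _ → ⅓) ℚ.≤? ℕtoℚ 1)
  oddCycle≤ (suc k) _ C = contradiction C (complete-¬longInducedOddCycle k)

1<sum⅓ : 4 ≤ n → 1ℚ <ℚ sumFin {n} (λ _ → ⅓)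
1<sum⅓ (s≤s (s≤s (s≤s (s≤s (z≤n {n}))))) = ℚ.<-≤-trans
  (from-yes (1ℚ ℚ.<? ⅓ +ℚ (⅓ +ℚ (⅓ +ℚ (⅓ +ℚ 0ℚ)))))
  (ℚ.+-monoʳ-≤ ⅓ (ℚ.+-monoʳ-≤ ⅓ (ℚ.+-monoʳ-≤ ⅓ (ℚ.+-monoʳ-≤ ⅓ (sumFin-nonneg {n} (λ _ → 0≤⅓))))))

complete-tImperfect : 4 ≤ n → ¬ TPerfect (complete n)
complete-tImperfect 4≤n perfect = ℚ.<-irrefl refl (ℚ.<-≤-trans (1<sum⅓ 4≤n)
  (complete-stableHull⇒sum≤1 (proj₁ (perfect _) ⅓∈P-complete)))

K4-induced⇒tImperfectProperTMinor : (G : Graph n) → InducedSubgraph K4 G → 4 < n →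
  HasTImperfectProperTMinor G
K4-induced⇒tImperfectProperTMinor G K4⊆G 4<n =
  4 , K4 , induced⇒TMinor K4⊆G 4<n , 4<n , complete-tImperfect ℕ.≤-refl

proposition4 : ∀ {n} (G : Graph n) → CoreGraph G → 4 < n →
    ¬ InducedSubgraph K4 G × ¬ InducedSubgraph (complement K4) G
proposition4 G (G-core , Gᶜ-core) 4<n =
  (λ K4⊆G → G-core (K4-induced⇒tImperfectProperTMinor G K4⊆G 4<n)) ,
  (λ K4ᶜ⊆G → Gᶜ-core (K4-induced⇒tImperfectProperTMinor (complement G)
    (complement-induced {H = K4} {G = G} K4ᶜ⊆G) 4<n))
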